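{- Let $n\geq 1$ and let $H$ be the tight $3$-uniform path on $n$ vertices, i.e. $V(H)=\{v_1,\ldots,v_n\}$ and $E(H)=\{\{v_i,v_{i+1},v_{i+2}\} : 1\leq i\leq n-2\}$. Then $b(H)=\left\lceil \sqrt{2n-1}\,\right\rceil$.
   Context: Round-based burning of a hypergraph $H$ (nonempty finite vertex set, finite family of edges that are subsets of the vertex set): let $F_0=\emptyset$. In each round $r=1,2,\ldots$ simultaneously: every vertex $v\notin F_{r-1}$ for which there is an edge $e$ with $|e|\geq 2$, $v\in e$ and $e\setminus\{v\}\subseteq F_{r-1}$ catches fire; and a chosen vertex $u_r\notin F_{r-1}$ (a source) is set on fire. $F_r$ is $F_{r-1}$ together with all vertices set on fire in round $r$. A sequence $(u_1,\ldots,u_k)$ with $u_r\notin F_{r-1}$ for all $r$ and $F_k=V(H)$ is a burning sequence; the burning number $b(H)$ is the minimum length of a burning sequence. -}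

module Defs where

open import Data.Nat using (ℕ; zero; suc; _+_; _*_; _∸_; _≤_; _<_; _≤?_)
open import Data.Fin using (Fin; toℕ)
open import Data.Fin.Subset using (Subset; _∈_; ∣_∣)
open import Data.Vec using (Vec; lookup; tabulate)
open import Data.List using (List; map; upTo)
open import Data.List.Membership.Propositional renaming (_∈_ to _∈ₗ_)
open import Data.Bool using (_∧_)
open import Data.Product using (Σ; ∃; _×_)
open import Data.Sum using (_⊎_)
open import Data.Empty using (⊥)
open import Relation.Nullary using (¬_)
open import Relation.Nullary.Decidable using (⌊_⌋)
open import Relation.Binary.PropositionalEquality using (_≡_; _≢_)

-- A hypergraph on the vertex set Fin n (nonemptiness imposed separately);
-- edges are subsets of the vertex set.
record Hypergraph (n : ℕ) : Set where
  field
    edges : List (Subset n)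
open Hypergraph public

Spread : ∀ {n} → Hypergraph n → (Fin n → Set) → Fin n → Set
Spread H F v = Σ (Subset _) λ e → (e ∈ₗ edges H) × (2 ≤ ∣ e ∣) × (v ∈ e)
               × (∀ w → w ∈ e → w ≢ v → F w)

-- Burned H us r v : v ∈ F_r for the source sequence us = (u_1,…,u_k),
-- where u_{r+1} = lookup us i with toℕ i ≡ r.
Burned : ∀ {n k} → Hypergraph n → Vec (Fin n) k → ℕ → Fin n → Set
Burned H us zero v = ⊥
Burned {k = k} H us (suc r) v =
  Burned H us r v ⊎ Spread H (Burned H us r) v
  ⊎ Σ (Fin k) λ i → (toℕ i ≡ r) × (lookup us i ≡ v)

IsBurningSequence : ∀ {n k} → Hypergraph n → Vec (Fin n) k → Set
IsBurningSequence {k = k} H us =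
  (∀ (i : Fin k) → ¬ Burned H us (toℕ i) (lookup us i))
  × (∀ v → Burned H us k v)

IsBurningNumber : ∀ {n} → Hypergraph n → ℕ → Set
IsBurningNumber {n} H b =
  (Σ (Vec (Fin n) b) λ us → IsBurningSequence H us)
  × (∀ k (us : Vec (Fin n) k) → IsBurningSequence H us → b ≤ k)

IsCeilSqrt : ℕ → ℕ → Set
IsCeilSqrt m c = ((c ∸ 1) * (c ∸ 1) < m) × (m ≤ c * c)

-- The edge {v_i, v_{i+1}, v_{i+2}} (0-indexed) as a subset of Fin n.
tripleAt : (n i : ℕ) → Subset n
tripleAt n i = tabulate λ j → ⌊ i ≤? toℕ j ⌋ ∧ ⌊ toℕ j ≤? i + 2 ⌋

tightPath : (n : ℕ) → Hypergraph n
tightPath n = record { edges = map (tripleAt n) (upTo (n ∸ 2)) }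

{-# OPTIONS --safe #-}
module Submission where

-- Upper bound: two adjacent sources grow by one vertex on each side per round, so pairs placed at
-- the centres of consecutive blocks of lengths 2c - 2, 2c - 6, … (and a single source last when c
-- is odd) burn ⌈c²/2⌉ ≥ n vertices in c rounds.  A planned source that is already burned is
-- replaced by any unburned vertex, which exists while fewer than n vertices burn.
--
-- Lower bound: let ψ count the maximal runs of burned vertices, runs of length ≥ 2 twice.
-- Spreading never increases ψ and a source raises it by at most 1, so ψ ≤ r after r rounds, and a
-- left-to-right scan shows that at most ψ rounded down to an even number of vertices catch fire in
-- one round.  So round r + 1 adds at most 1 + 2⌊r/2⌋ vertices and r rounds burn at most ⌈r²/2⌉.
--
-- Finally ⌈r²/2⌉ ≥ n iff r² ≥ 2n - 1, i.e. iff r ≥ ⌈√(2n - 1)⌉.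

open import Defs
open import Data.Bool using (Bool; true; false; T; not; _∧_; _∨_; _xor_)
open import Data.Bool.Properties
  using (T-∧; T-≡; not-involutive; ∨-zeroʳ; ∨-identityʳ; ¬-not) renaming (_≟_ to _≟ᴮ_)
open import Data.Empty using (⊥; ⊥-elim)
open import Data.Fin as Fin using (Fin; toℕ; fromℕ<)
open import Data.Fin.Properties using (toℕ<n; toℕ-fromℕ<; toℕ-injective; any?)
open import Data.Fin.Subset using (Subset; _∈_; _⊆_; ⁅_⁆; ∣_∣)
open import Data.Fin.Subset.Properties using (p⊂q⇒∣p∣<∣q∣; ∣⁅x⁆∣≡1; x∈⁅y⁆⇒x≡y; x≢y⇒x∉⁅y⁆)
open import Data.List using (map; upTo)
open import Data.List.Membership.Propositional.Properties using (∈-map⁺; ∈-map⁻; ∈-upTo⁺; ∈-upTo⁻)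
open import Data.Nat
  using (ℕ; zero; suc; _+_; _*_; _∸_; _≤_; _<_; z≤n; s≤s; _≤ᵇ_; _<ᵇ_; _≡ᵇ_; _≟_; _<?_; _≤?_; _⊓_; pred)
open import Data.Nat.Properties
open import Algebra.Properties.CommutativeSemigroup +-commutativeSemigroup using (interchange; xy∙z≈xz∙y)
open import Data.Nat.Tactic.RingSolver using (solve-∀)
open import Data.Product using (Σ; ∃; _×_; _,_; proj₁; proj₂)
open import Data.Sum using (_⊎_; inj₁; inj₂)
open import Data.Vec using (Vec; []; _∷_; lookup; tabulate)
open import Data.Vec.Properties using (lookup∘tabulate; []=⇒lookup; lookup⇒[]=)
open import Function using (_∘_; Equivalence)
open import Relation.Nullary using (Dec; does; ¬_; yes; no)
open import Relation.Nullary.Decidable using (dec-true; dec-false; toWitness; fromWitness)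
open import Relation.Binary.PropositionalEquality

ind : Bool → ℕ
ind true  = 1
ind false = 0

ind≤1 : ∀ b → ind b ≤ 1
ind≤1 true  = ≤-refl
ind≤1 false = z≤n

sumBelow : ℕ → (ℕ → ℕ) → ℕ
sumBelow zero    t = 0
sumBelow (suc N) t = sumBelow N t + t N

module _ {t t′ : ℕ → ℕ} where

  sumBelow-cong : ∀ N → (∀ j → j < N → t j ≡ t′ j) → sumBelow N t ≡ sumBelow N t′
  sumBelow-cong zero    _  = refl
  sumBelow-cong (suc N) eq =
    cong₂ _+_ (sumBelow-cong N (λ j j<N → eq j (m<n⇒m<1+n j<N))) (eq N ≤-refl)

  sumBelow-mono-≤ : ∀ N → (∀ j → j < N → t j ≤ t′ j) → sumBelow N t ≤ sumBelow N t′
  sumBelow-mono-≤ zero    _  = z≤n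
  sumBelow-mono-≤ (suc N) le =
    +-mono-≤ (sumBelow-mono-≤ N (λ j j<N → le j (m<n⇒m<1+n j<N))) (le N ≤-refl)

  sumBelow-+ : ∀ N → sumBelow N (λ j → t j + t′ j) ≡ sumBelow N t + sumBelow N t′
  sumBelow-+ zero    = refl
  sumBelow-+ (suc N) = begin
    sumBelow N (λ j → t j + t′ j) + (t N + t′ N) ≡⟨ cong (_+ (t N + t′ N)) (sumBelow-+ N) ⟩
    sumBelow N t + sumBelow N t′ + (t N + t′ N)  ≡⟨ interchange (sumBelow N t) (sumBelow N t′) (t N) (t′ N) ⟩
    sumBelow N t + t N + (sumBelow N t′ + t′ N)  ∎
    where open ≡-Reasoning

sumBelow-const : ∀ N m → sumBelow N (λ _ → m) ≡ N * m
sumBelow-const zero    m = refl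
sumBelow-const (suc N) m = trans (cong (_+ m) (sumBelow-const N m)) (+-comm (N * m) m)

sumBelow-indicator : ∀ N k → sumBelow N (λ j → ind (j ≡ᵇ k)) ≡ ind (k <ᵇ N)
sumBelow-indicator zero    k = refl
sumBelow-indicator (suc N) k rewrite sumBelow-indicator N k = step k N
  where
  step : ∀ k N → ind (k <ᵇ N) + ind (N ≡ᵇ k) ≡ ind (k <ᵇ suc N)
  step zero    zero    = refl
  step zero    (suc N) = refl
  step (suc k) zero    = refl
  step (suc k) (suc N) = step k N

sumBelow-split : ∀ m v t → sumBelow (m + v) t ≡ sumBelow v t + sumBelow m (λ i → t (i + v))
sumBelow-split zero    v t = sym (+-identityʳ _)
sumBelow-split (suc m) v t = trans (cong (_+ t (m + v)) (sumBelow-split m v t))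
  (+-assoc (sumBelow v t) (sumBelow m (λ i → t (i + v))) (t (m + v)))

sumBelow-monoˡ : ∀ {N M} t → N ≤ M → sumBelow N t ≤ sumBelow M t
sumBelow-monoˡ {N} {M} t N≤M = begin
  sumBelow N t                                      ≤⟨ m≤m+n _ _ ⟩
  sumBelow N t + sumBelow (M ∸ N) (λ i → t (i + N)) ≡⟨ sumBelow-split (M ∸ N) N t ⟨
  sumBelow (M ∸ N + N) t                            ≡⟨ cong (λ K → sumBelow K t) (m∸n+n≡m N≤M) ⟩
  sumBelow M t                                      ∎
  where open ≤-Reasoning

sumBelow-local : ∀ {t t′ : ℕ → ℕ} {δ} w v {N} → w + v ≤ N →
  (∀ j → j < v → t′ j ≡ t j) → (∀ j → w + v ≤ j → t′ j ≡ t j) →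
  sumBelow w (λ i → t′ (i + v)) ≤ sumBelow w (λ i → t (i + v)) + δ →
  sumBelow N t′ ≤ sumBelow N t + δ
sumBelow-local {t} {t′} {δ} w v {N} w+v≤N below above inWindow = begin
  sumBelow N t′                        ≡⟨ parts t′ ⟩
  sumBelow v t′ + window t′ + rest t′  ≡⟨ cong₂ (λ x y → x + window t′ + y) (sumBelow-cong v below)
                                                (sumBelow-cong m (λ i _ → above (i + (w + v)) (m≤n+m _ i))) ⟩
  sumBelow v t + window t′ + rest t    ≤⟨ +-monoˡ-≤ (rest t) (+-monoʳ-≤ (sumBelow v t) inWindow) ⟩
  sumBelow v t + (window t + δ) + rest t ≡⟨ cong (_+ rest t) (+-assoc (sumBelow v t) (window t) δ) ⟨
  sumBelow v t + window t + δ + rest t ≡⟨ xy∙z≈xz∙y (sumBelow v t + window t) δ (rest t) ⟩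
  sumBelow v t + window t + rest t + δ ≡⟨ cong (_+ δ) (parts t) ⟨
  sumBelow N t + δ                     ∎
  where
  open ≤-Reasoning
  m : ℕ
  m = N ∸ (w + v)
  window rest : (ℕ → ℕ) → ℕ
  window u = sumBelow w (λ i → u (i + v))
  rest   u = sumBelow m (λ i → u (i + (w + v)))
  parts : ∀ u → sumBelow N u ≡ sumBelow v u + window u + rest u
  parts u = begin-equality
    sumBelow N u                ≡⟨ cong (λ K → sumBelow K u) (m∸n+n≡m w+v≤N) ⟨
    sumBelow (m + (w + v)) u    ≡⟨ sumBelow-split m (w + v) u ⟩
    sumBelow (w + v) u + rest u ≡⟨ cong (_+ rest u) (sumBelow-split w v u) ⟩
    sumBelow v u + window u + rest u ∎

sumBelow-telescope : ∀ {a b P : ℕ → ℕ} N → (∀ j → a j + P j ≤ b j + P (suc j)) →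
  sumBelow N a + P 0 ≤ sumBelow N b + P N
sumBelow-telescope zero _ = ≤-refl
sumBelow-telescope {a} {b} {P} (suc N) step = begin
  sumBelow N a + a N + P 0         ≡⟨ xy∙z≈xz∙y (sumBelow N a) (a N) (P 0) ⟩
  sumBelow N a + P 0 + a N         ≤⟨ +-monoˡ-≤ (a N) (sumBelow-telescope N step) ⟩
  sumBelow N b + P N + a N         ≡⟨ xy∙z≈xz∙y (sumBelow N b) (P N) (a N) ⟩
  sumBelow N b + a N + P N         ≡⟨ +-assoc (sumBelow N b) (a N) (P N) ⟩
  sumBelow N b + (a N + P N)       ≤⟨ +-monoʳ-≤ (sumBelow N b) (step N) ⟩
  sumBelow N b + (b N + P (suc N)) ≡⟨ +-assoc (sumBelow N b) (b N) (P (suc N)) ⟨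
  sumBelow N b + b N + P (suc N)   ∎
  where open ≤-Reasoning

BoolFun : ℕ → Set
BoolFun zero    = ℕ
BoolFun (suc k) = Bool → BoolFun k

Everywhere≤ : ∀ k → BoolFun k → BoolFun k → Set
Everywhere≤ zero    m n = m ≤ n
Everywhere≤ (suc k) f g = ∀ b → Everywhere≤ k (f b) (g b)

everywhere≤ᵇ : ∀ k → BoolFun k → BoolFun k → Bool
everywhere≤ᵇ zero    m n = m ≤ᵇ n
everywhere≤ᵇ (suc k) f g = everywhere≤ᵇ k (f false) (g false) ∧ everywhere≤ᵇ k (f true) (g true)

everywhere≤-byCases : ∀ k f g → T (everywhere≤ᵇ k f g) → Everywhere≤ k f g
everywhere≤-byCases zero    m n holds       = ≤ᵇ⇒≤ m n holds
everywhere≤-byCases (suc k) f g holds false =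
  everywhere≤-byCases k (f false) (g false) (proj₁ (Equivalence.to T-∧ holds))
everywhere≤-byCases (suc k) f g holds true  =
  everywhere≤-byCases k (f true) (g true) (proj₂ (Equivalence.to T-∧ holds))

clash : ∀ {b} → b ≡ false → b ≡ true → ⊥
clash refl ()

Implies : Bool → Bool → Set
Implies a a′ = a ≡ true → a′ ≡ true

Implies-∧ : ∀ {a a′ b b′} → Implies a a′ → Implies b b′ → Implies (a ∧ b) (a′ ∧ b′)
Implies-∧ {true} {b = true} a⇒a′ b⇒b′ _ rewrite a⇒a′ refl | b⇒b′ refl = refl

Implies-∨ : ∀ {a a′ b b′} → Implies a a′ → Implies b b′ → Implies (a ∨ b) (a′ ∨ b′)
Implies-∨ {true}             a⇒a′ _    _ rewrite a⇒a′ refl = refl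
Implies-∨ {false} {b = true} _    b⇒b′ _ rewrite b⇒b′ refl = ∨-zeroʳ _

-- A vertex catches fire iff the other two vertices of one of the three edges through it burn:
-- a, b are the two vertices to its left and d, e the two to its right.
catches : Bool → Bool → Bool → Bool → Bool
catches a b d e = (a ∧ b) ∨ (b ∧ d) ∨ (d ∧ e)

catches-mono : ∀ {a b d e a′ b′ d′ e′} →
  Implies a a′ → Implies b b′ → Implies d d′ → Implies e e′ → Implies (catches a b d e) (catches a′ b′ d′ e′)
catches-mono a⇒ b⇒ d⇒ e⇒ = Implies-∨ (Implies-∧ a⇒ b⇒) (Implies-∨ (Implies-∧ b⇒ d⇒) (Implies-∧ d⇒ e⇒))

catches-left : ∀ {a b d e} → a ≡ true → b ≡ true → catches a b d e ≡ true
catches-left refl refl = refl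

catches-middle : ∀ {a b d e} → b ≡ true → d ≡ true → catches a b d e ≡ true
catches-middle {a} refl refl = ∨-zeroʳ (a ∧ true)

catches-right : ∀ {a b d e} → d ≡ true → e ≡ true → catches a b d e ≡ true
catches-right {a} {b} refl refl rewrite ∨-zeroʳ (b ∧ true) = ∨-zeroʳ (a ∧ b)

catches-cases : ∀ {a b d e} → catches a b d e ≡ true →
  (a ≡ true × b ≡ true) ⊎ (b ≡ true × d ≡ true) ⊎ (d ≡ true × e ≡ true)
catches-cases {_}     {true}  {true}          _  = inj₂ (inj₁ (refl , refl))
catches-cases {true}  {true}  {false}         _  = inj₁ (refl , refl)
catches-cases {false} {true}  {false}         ()
catches-cases {_}     {false} {true}  {true}  _  = inj₂ (inj₂ (refl , refl))
catches-cases {true}  {false} {true}  {false} ()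
catches-cases {false} {false} {true}  {false} ()
catches-cases {true}  {false} {false}         ()
catches-cases {false} {false} {false}         ()

runWeight : Bool → Bool → Bool → ℕ
runWeight a b c = ind (not a ∧ b) + ind (not a ∧ b ∧ c)

windowWeight : Bool → Bool → Bool → Bool → Bool → ℕ
windowWeight a b x d e = runWeight a b x + runWeight b x d + runWeight x d e

windowWeight-catches : ∀ a b x d e → windowWeight a b (x ∨ catches a b d e) d e ≤ windowWeight a b x d e
windowWeight-catches = everywhere≤-byCases 5
  (λ a b x d e → windowWeight a b (x ∨ catches a b d e) d e) (λ a b x d e → windowWeight a b x d e) _

windowWeight-∨ : ∀ a b x d e y → windowWeight a b (x ∨ y) d e ≤ windowWeight a b x d e + 1
windowWeight-∨ = everywhere≤-byCases 6
  (λ a b x d e y → windowWeight a b (x ∨ y) d e) (λ a b x d e y → windowWeight a b x d e + 1) _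

parity : ℕ → Bool
parity zero    = false
parity (suc m) = not (parity m)

parity-+ : ∀ m r → parity (m + r) ≡ parity m xor parity r
parity-+ zero    r = refl
parity-+ (suc m) r rewrite parity-+ m r with parity m
... | true  = not-involutive (parity r)
... | false = refl

-- A potential for the left-to-right scan in spreadCount+parity≤ψ, in terms of four consecutive
-- cells and the parity of the part of ψ already scanned.  It was found by a computer search; only
-- the three lemmas below are used about it.
scanPotential : Bool → Bool → Bool → Bool → Bool → ℕ
scanPotential _     false false _     p = 2 ∸ ind p
scanPotential _     false true  false _ = 2
scanPotential _     false true  true  p = 3 ∸ ind p
scanPotential false true  false false p = 2 + ind p
scanPotential false true  false true  _ = 2
scanPotential false true  true  _     p = 3 ∸ ind p
scanPotential true  true  false true  _ = 1
scanPotential true  true  _     _     p = 1 ∸ ind p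

scanPotential-step : ∀ a b c d e p →
  ind (not c ∧ catches a b d e) + scanPotential a b c d p
    ≤ runWeight a b c + scanPotential b c d e (p xor parity (runWeight a b c))
scanPotential-step = everywhere≤-byCases 6
  (λ a b c d e p → ind (not c ∧ catches a b d e) + scanPotential a b c d p)
  (λ a b c d e p → runWeight a b c + scanPotential b c d e (p xor parity (runWeight a b c))) _

scanPotential-start : ∀ c d → 2 ≤ scanPotential false false c d false
scanPotential-start = everywhere≤-byCases 2 (λ _ _ → 2) (λ c d → scanPotential false false c d false) _

scanPotential-end : ∀ p → scanPotential false false false false p + ind p ≡ 2
scanPotential-end true  = refl
scanPotential-end false = refl

-- The bound ⌈r²/2⌉

evenPart : ℕ → ℕ
evenPart zero          = 0
evenPart (suc zero)    = 0
evenPart (suc (suc r)) = 2 + evenPart r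

evenPart+parity : ∀ r → evenPart r + ind (parity r) ≡ r
evenPart+parity zero          = refl
evenPart+parity (suc zero)    = refl
evenPart+parity (suc (suc r)) rewrite not-involutive (parity r) = cong (2 +_) (evenPart+parity r)

evenPart+evenPart-suc : ∀ r → evenPart r + evenPart (suc r) ≡ 2 * r
evenPart+evenPart-suc zero          = refl
evenPart+evenPart-suc (suc zero)    = refl
evenPart+evenPart-suc (suc (suc r)) = begin
  2 + evenPart r + (2 + evenPart (suc r)) ≡⟨ shuffle (evenPart r) (evenPart (suc r)) ⟩
  4 + (evenPart r + evenPart (suc r))     ≡⟨ cong (4 +_) (evenPart+evenPart-suc r) ⟩
  4 + 2 * r                               ≡⟨ double r ⟩
  2 * (2 + r)                             ∎
  where
  open ≡-Reasoning
  shuffle : ∀ a b → 2 + a + (2 + b) ≡ 4 + (a + b)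
  shuffle = solve-∀
  double : ∀ r → 4 + 2 * r ≡ 2 * (2 + r)
  double = solve-∀

≤-evenPart : ∀ {g m r} → g + ind (parity m) ≤ m → m ≤ r → g ≤ evenPart r
≤-evenPart {g} {m} {r} g+p≤m m≤r with m≤n⇒m<n∨m≡n m≤r
... | inj₂ refl = +-cancelʳ-≤ (ind (parity r)) g (evenPart r)
                    (subst (g + ind (parity r) ≤_) (sym (evenPart+parity r)) g+p≤m)
... | inj₁ m<r = ≤-pred (begin
  suc g                          ≤⟨ s≤s (≤-trans (m≤m+n g _) g+p≤m) ⟩
  suc m                          ≤⟨ m<r ⟩
  r                              ≡⟨ sym (evenPart+parity r) ⟩
  evenPart r + ind (parity r)    ≤⟨ +-monoʳ-≤ (evenPart r) (ind≤1 (parity r)) ⟩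
  evenPart r + 1                 ≡⟨ +-comm (evenPart r) 1 ⟩
  suc (evenPart r)               ∎)
  where
  open ≤-Reasoning

maxBurned : ℕ → ℕ
maxBurned zero    = 0
maxBurned (suc r) = maxBurned r + suc (evenPart r)

maxBurned-mono : ∀ {r r′} → r ≤ r′ → maxBurned r ≤ maxBurned r′
maxBurned-mono {r′ = zero}   z≤n = ≤-refl
maxBurned-mono {r′ = suc r′} r≤1+r′ with m≤n⇒m<n∨m≡n r≤1+r′
... | inj₁ r<1+r′ = ≤-trans (maxBurned-mono (≤-pred r<1+r′)) (m≤m+n _ _)
... | inj₂ refl   = ≤-refl

maxBurned-+2 : ∀ r → maxBurned (2 + r) ≡ maxBurned r + (2 + 2 * r)
maxBurned-+2 r = begin
  maxBurned r + suc (evenPart r) + suc (evenPart (suc r))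
    ≡⟨ shuffle (maxBurned r) (evenPart r) (evenPart (suc r)) ⟩
  maxBurned r + (2 + (evenPart r + evenPart (suc r)))
    ≡⟨ cong (λ x → maxBurned r + (2 + x)) (evenPart+evenPart-suc r) ⟩
  maxBurned r + (2 + 2 * r)
    ∎
  where
  open ≡-Reasoning
  shuffle : ∀ f a b → f + suc a + suc b ≡ f + (2 + (a + b))
  shuffle = solve-∀

2*maxBurned≤ : ∀ r → 2 * maxBurned r ≤ r * r + 1
2*maxBurned≤ zero          = z≤n
2*maxBurned≤ (suc zero)    = ≤-refl
2*maxBurned≤ (suc (suc r)) = begin
  2 * maxBurned (2 + r)          ≡⟨ cong (2 *_) (maxBurned-+2 r) ⟩
  2 * (maxBurned r + (2 + 2 * r)) ≡⟨ expand (maxBurned r) r ⟩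
  2 * maxBurned r + (4 + 4 * r)   ≤⟨ +-monoˡ-≤ (4 + 4 * r) (2*maxBurned≤ r) ⟩
  r * r + 1 + (4 + 4 * r)         ≡⟨ square r ⟩
  (2 + r) * (2 + r) + 1           ∎
  where
  open ≤-Reasoning
  expand : ∀ f r → 2 * (f + (2 + 2 * r)) ≡ 2 * f + (4 + 4 * r)
  expand = solve-∀
  square : ∀ r → r * r + 1 + (4 + 4 * r) ≡ (2 + r) * (2 + r) + 1
  square = solve-∀

≤2*maxBurned : ∀ r → r * r ≤ 2 * maxBurned r
≤2*maxBurned zero          = z≤n
≤2*maxBurned (suc zero)    = s≤s z≤n
≤2*maxBurned (suc (suc r)) = begin
  (2 + r) * (2 + r)               ≡⟨ square r ⟩
  r * r + (4 + 4 * r)             ≤⟨ +-monoˡ-≤ (4 + 4 * r) (≤2*maxBurned r) ⟩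
  2 * maxBurned r + (4 + 4 * r)   ≡⟨ expand (maxBurned r) r ⟩
  2 * (maxBurned r + (2 + 2 * r)) ≡⟨ cong (2 *_) (maxBurned-+2 r) ⟨
  2 * maxBurned (2 + r)           ∎
  where
  open ≤-Reasoning
  square : ∀ r → (2 + r) * (2 + r) ≡ r * r + (4 + 4 * r)
  square = solve-∀
  expand : ∀ f r → 2 * f + (4 + 4 * r) ≡ 2 * (f + (2 + 2 * r))
  expand = solve-∀

-- The burning process on cells and the lower bound

-- Cell 2 + v holds vertex v, so that the two left neighbours of a vertex are always cells; the
-- cells 0 and 1 and those past the path never burn (Padded).
State : Set
State = ℕ → Bool

_⊑_ : State → State → Set
G ⊑ G′ = ∀ x → G x ≡ true → G′ x ≡ true

Strategy : Set
Strategy = ℕ → State → ℕ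

oblivious : (ℕ → ℕ) → Strategy
oblivious s r _ = s r

igniteIf : Bool → ℕ → State → State
igniteIf false k H   = H
igniteIf true  k H x = H x ∨ does (x ≟ 2 + k)

igniteIf-⊒ : ∀ b k H → H ⊑ igniteIf b k H
igniteIf-⊒ false k H x Hx = Hx
igniteIf-⊒ true  k H x Hx rewrite Hx = refl

igniteIf-other : ∀ b k H {x} → x ≢ 2 + k → igniteIf b k H x ≡ H x
igniteIf-other false k H     _   = refl
igniteIf-other true  k H {x} x≢ rewrite dec-false (x ≟ 2 + k) x≢ = ∨-identityʳ (H x)

igniteIf-target : ∀ b k H → b ≡ true → igniteIf b k H (2 + k) ≡ true
igniteIf-target .true k H refl rewrite dec-true (2 + k ≟ 2 + k) refl = ∨-zeroʳ (H (2 + k))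

igniteIf-cases : ∀ b k H x → igniteIf b k H x ≡ true → H x ≡ true ⊎ (b ≡ true × x ≡ 2 + k)
igniteIf-cases false k H x Hx = inj₁ Hx
igniteIf-cases true  k H x burns with H x
... | true  = inj₁ refl
... | false = inj₂ (refl , ≡ᵇ⇒≡ x (2 + k) (subst T (sym burns) _))

module Fire (n : ℕ) where

  catchesAt : State → ℕ → Bool
  catchesAt G v = catches (G v) (G (1 + v)) (G (3 + v)) (G (4 + v))

  -- Whether a vertex catches is decided in G, the state before the round; igniting the vertices
  -- one at a time lets ψ be followed by a local argument.
  spreadBelow : ℕ → State → State
  spreadBelow zero    G = G
  spreadBelow (suc k) G = igniteIf (catchesAt G k) k (spreadBelow k G)

  addSource : ℕ → State → State
  addSource s = igniteIf (s <ᵇ n) s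

  round : ℕ → State → State
  round s G = addSource s (spreadBelow n G)

  fire : Strategy → ℕ → State
  fire σ zero    _ = false
  fire σ (suc r)   = round (σ r (fire σ r)) (fire σ r)

  catchesAt-mono : ∀ {G G′} → G ⊑ G′ → ∀ v → catchesAt G v ≡ true → catchesAt G′ v ≡ true
  catchesAt-mono G⊑G′ v = catches-mono (G⊑G′ v) (G⊑G′ (1 + v)) (G⊑G′ (3 + v)) (G⊑G′ (4 + v))

  spreadBelow-⊒ : ∀ {G} k → G ⊑ spreadBelow k G
  spreadBelow-⊒     zero    x Gx = Gx
  spreadBelow-⊒ {G} (suc k) x Gx =
    igniteIf-⊒ (catchesAt G k) k (spreadBelow k G) x (spreadBelow-⊒ k x Gx)

  spreadBelow-catch : ∀ {G v} k → v < k → catchesAt G v ≡ true → spreadBelow k G (2 + v) ≡ true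
  spreadBelow-catch {G} {v} (suc k) v<1+k catch with m≤n⇒m<n∨m≡n v<1+k
  ... | inj₁ v<k  =
    igniteIf-⊒ (catchesAt G k) k (spreadBelow k G) (2 + v) (spreadBelow-catch k (≤-pred v<k) catch)
  ... | inj₂ refl = igniteIf-target (catchesAt G k) k (spreadBelow k G) catch

  -- is-source takes v ≡ s as an argument so that matching on it never has to unify s with a term.
  data BurnsInRound (s : ℕ) (G : State) : ℕ → Set where
    was-burned : ∀ {x} → G x ≡ true → BurnsInRound s G x
    caught     : ∀ {v} → v < n → catchesAt G v ≡ true → BurnsInRound s G (2 + v)
    is-source  : ∀ {v} → v ≡ s → s < n → BurnsInRound s G (2 + v)

  round-burns : ∀ {s G x} → BurnsInRound s G x → round s G x ≡ true
  round-burns {s} {G} (was-burned Gx)      =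
    igniteIf-⊒ (s <ᵇ n) s (spreadBelow n G) _ (spreadBelow-⊒ n _ Gx)
  round-burns {s} {G} (caught v<n catch)   =
    igniteIf-⊒ (s <ᵇ n) s (spreadBelow n G) _ (spreadBelow-catch n v<n catch)
  round-burns {s} {G} (is-source refl s<n) =
    igniteIf-target (s <ᵇ n) s (spreadBelow n G) (dec-true (s <? n) s<n)

  round-burns⁻¹ : ∀ {s G x} → round s G x ≡ true → BurnsInRound s G x
  round-burns⁻¹ {s} {G} {x} burns with igniteIf-cases (s <ᵇ n) s (spreadBelow n G) x burns
  ... | inj₂ (s<ᵇn , refl) = is-source refl (<ᵇ⇒< s n (subst T (sym s<ᵇn) _))
  ... | inj₁ spread        = fromSpread n ≤-refl spread
    where
    fromSpread : ∀ k → k ≤ n → spreadBelow k G x ≡ true → BurnsInRound s G x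
    fromSpread zero    _     Gx     = was-burned Gx
    fromSpread (suc k) 1+k≤n burned with igniteIf-cases (catchesAt G k) k (spreadBelow k G) x burned
    ... | inj₁ earlier        = fromSpread k (<⇒≤ 1+k≤n) earlier
    ... | inj₂ (catch , refl) = caught 1+k≤n catch

  round-⊒ : ∀ {s G} → G ⊑ round s G
  round-⊒ x Gx = round-burns (was-burned Gx)

  round-mono : ∀ {s s′ G G′} → G ⊑ G′ → G′ (2 + s) ≡ true ⊎ s′ ≡ s → round s G ⊑ round s′ G′
  round-mono G⊑G′ alternative x burns with round-burns⁻¹ burns | alternative
  ... | was-burned Gx      | _         = round-⊒ x (G⊑G′ x Gx)
  ... | caught v<n catch   | _         = round-burns (caught v<n (catchesAt-mono G⊑G′ _ catch))
  ... | is-source refl _   | inj₁ G′s  = round-⊒ x G′s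
  ... | is-source refl s<n | inj₂ refl = round-burns (is-source refl s<n)

  fire-⊑ : ∀ σ σ′ r →
    (∀ j → j < r → fire σ′ j (2 + σ j (fire σ j)) ≡ true ⊎ σ′ j (fire σ′ j) ≡ σ j (fire σ j)) →
    fire σ r ⊑ fire σ′ r
  fire-⊑ σ σ′ zero    _     _ ()
  fire-⊑ σ σ′ (suc r) agree =
    round-mono (fire-⊑ σ σ′ r (λ j j<r → agree j (m<n⇒m<1+n j<r))) (agree r ≤-refl)

  record Padded (G : State) : Set where
    field
      cell0  : G 0 ≡ false
      cell1  : G 1 ≡ false
      beyond : ∀ v → n ≤ v → G (2 + v) ≡ false

  round-padded : ∀ {s G} → Padded G → Padded (round s G)
  round-padded {s} {G} padded = record
    { cell0  = unburned λ { (was-burned G0) → clash (Padded.cell0 padded) G0 }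
    ; cell1  = unburned λ { (was-burned G1) → clash (Padded.cell1 padded) G1 }
    ; beyond = λ v n≤v → unburned λ
        { (was-burned Gv)      → clash (Padded.beyond padded v n≤v) Gv
        ; (caught v<n _)       → <⇒≱ v<n n≤v
        ; (is-source refl s<n) → <⇒≱ s<n n≤v }
    }
    where
    unburned : ∀ {x} → ¬ BurnsInRound s G x → round s G x ≡ false
    unburned never = ¬-not (λ burns → never (round-burns⁻¹ burns))

  fire-padded : ∀ σ r → Padded (fire σ r)
  fire-padded σ zero    = record { cell0 = refl ; cell1 = refl ; beyond = λ _ _ → refl }
  fire-padded σ (suc r) = round-padded (fire-padded σ r)

  padded-< : ∀ {G v} → Padded G → G (2 + v) ≡ true → v < n
  padded-< {v = v} padded Gv with v <? n
  ... | yes v<n = v<n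
  ... | no  v≮n = ⊥-elim (clash (Padded.beyond padded v (≮⇒≥ v≮n)) Gv)

  burnedCount : State → ℕ
  burnedCount G = sumBelow n (λ v → ind (G (2 + v)))

  ignites : State → ℕ → Bool
  ignites G v = not (G (2 + v)) ∧ catchesAt G v

  spreadCount : State → ℕ
  spreadCount G = sumBelow n (λ v → ind (ignites G v))

  burnedCount-full : ∀ {G} → (∀ v → v < n → G (2 + v) ≡ true) → burnedCount G ≡ n
  burnedCount-full {G} full = begin
    sumBelow n (λ v → ind (G (2 + v))) ≡⟨ sumBelow-cong n (λ v v<n → cong ind (full v v<n)) ⟩
    sumBelow n (λ _ → 1)               ≡⟨ sumBelow-const n 1 ⟩
    n * 1                              ≡⟨ *-identityʳ n ⟩
    n                                  ∎
    where open ≡-Reasoning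

  ind-round : ∀ s G v → ind (round s G (2 + v)) ≤ ind (G (2 + v)) + ind (ignites G v) + ind (v ≡ᵇ s)
  ind-round s G v with round s G (2 + v) in burns
  ... | false = z≤n
  ... | true with round-burns⁻¹ burns
  ...   | was-burned Gv rewrite Gv = s≤s z≤n
  ...   | is-source refl _ rewrite dec-true (v ≟ v) refl = m≤n+m 1 _
  ...   | caught _ catch with G (2 + v)
  ...     | true  = s≤s z≤n
  ...     | false rewrite catch = s≤s z≤n

  burnedCount-round : ∀ s G → burnedCount (round s G) ≤ burnedCount G + spreadCount G + 1
  burnedCount-round s G = begin
    burnedCount (round s G)
      ≤⟨ sumBelow-mono-≤ n (λ v _ → ind-round s G v) ⟩
    sumBelow n (λ v → ind (G (2 + v)) + ind (ignites G v) + ind (v ≡ᵇ s))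
      ≡⟨ sumBelow-+ n ⟩
    sumBelow n (λ v → ind (G (2 + v)) + ind (ignites G v)) + sumBelow n (λ v → ind (v ≡ᵇ s))
      ≡⟨ cong₂ _+_ (sumBelow-+ n) (sumBelow-indicator n s) ⟩
    burnedCount G + spreadCount G + ind (s <ᵇ n)
      ≤⟨ +-monoʳ-≤ (burnedCount G + spreadCount G) (ind≤1 (s <ᵇ n)) ⟩
    burnedCount G + spreadCount G + 1
      ∎
    where open ≤-Reasoning

  ψAt : State → ℕ → ℕ
  ψAt G j = runWeight (G j) (G (1 + j)) (G (2 + j))

  ψ : State → ℕ
  ψ G = sumBelow (3 + n) (ψAt G)

  ψ-update : ∀ {H H′ δ} k → k ≤ n → (∀ x → x ≢ 2 + k → H′ x ≡ H x) →
    windowWeight (H k) (H (1 + k)) (H′ (2 + k)) (H (3 + k)) (H (4 + k))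
      ≤ windowWeight (H k) (H (1 + k)) (H (2 + k)) (H (3 + k)) (H (4 + k)) + δ →
    ψ H′ ≤ ψ H + δ
  ψ-update {H} {H′} k k≤n same local =
    sumBelow-local 3 k (+-monoʳ-≤ 3 k≤n)
      (λ j j<k    → unchanged j (λ i i≤2 → <⇒≢ (+-mono-≤-< i≤2 j<k)))
      (λ j 3+k≤j → unchanged j (λ i _ → >⇒≢ (≤-trans 3+k≤j (m≤n+m j i))))
      window
    where
    unchanged : ∀ j → (∀ i → i ≤ 2 → i + j ≢ 2 + k) → ψAt H′ j ≡ ψAt H j
    unchanged j far
      rewrite same j (far 0 z≤n) | same (1 + j) (far 1 (s≤s z≤n)) | same (2 + j) (far 2 ≤-refl) = refl
    window : ψAt H′ k + ψAt H′ (1 + k) + ψAt H′ (2 + k) ≤ ψAt H k + ψAt H (1 + k) + ψAt H (2 + k) + _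
    window
      rewrite same k (m≢1+n+m k {1}) | same (1 + k) (m≢1+n+m (1 + k) {0})
            | same (3 + k) (≢-sym (m≢1+n+m (2 + k) {0})) | same (4 + k) (≢-sym (m≢1+n+m (2 + k) {1}))
      = local

  ψ-igniteIf : ∀ b k H → k ≤ n → ψ (igniteIf b k H) ≤ ψ H + 1
  ψ-igniteIf false k H _   = m≤m+n (ψ H) 1
  ψ-igniteIf true  k H k≤n =
    ψ-update k k≤n (λ x → igniteIf-other true k H)
      (windowWeight-∨ (H k) (H (1 + k)) (H (2 + k)) (H (3 + k)) (H (4 + k)) (does (2 + k ≟ 2 + k)))

  ψ-addSource : ∀ s H → ψ (addSource s H) ≤ ψ H + 1
  ψ-addSource s H with s <? n
  ... | yes s<n = ψ-igniteIf (s <ᵇ n) s H (<⇒≤ s<n)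
  ... | no  s≮n =
    subst (λ b → ψ (igniteIf b s H) ≤ ψ H + 1) (sym (dec-false (s <? n) s≮n)) (m≤m+n (ψ H) 1)

  ψ-spreadStep : ∀ {G H} k → k < n → G ⊑ H → ψ (igniteIf (catchesAt G k) k H) ≤ ψ H
  ψ-spreadStep {G} {H} k k<n G⊑H with catchesAt G k in catch
  ... | false = ≤-refl
  ... | true  = subst (ψ (igniteIf true k H) ≤_) (+-identityʳ (ψ H))
                  (ψ-update k (<⇒≤ k<n) (λ x → igniteIf-other true k H) window)
    where
    a b x d e : Bool
    a = H k
    b = H (1 + k)
    x = H (2 + k)
    d = H (3 + k)
    e = H (4 + k)
    window : windowWeight a b (x ∨ does (2 + k ≟ 2 + k)) d e ≤ windowWeight a b x d e + 0
    window = begin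
      windowWeight a b (x ∨ does (2 + k ≟ 2 + k)) d e
        ≡⟨ cong (λ y → windowWeight a b (x ∨ y) d e)
                (trans (dec-true (2 + k ≟ 2 + k) refl) (sym (catchesAt-mono G⊑H k catch))) ⟩
      windowWeight a b (x ∨ catches a b d e) d e ≤⟨ windowWeight-catches a b x d e ⟩
      windowWeight a b x d e                     ≤⟨ m≤m+n _ 0 ⟩
      windowWeight a b x d e + 0                 ∎
      where open ≤-Reasoning

  ψ-spreadBelow : ∀ G k → k ≤ n → ψ (spreadBelow k G) ≤ ψ G
  ψ-spreadBelow G zero    _     = ≤-refl
  ψ-spreadBelow G (suc k) 1+k≤n =
    ≤-trans (ψ-spreadStep k 1+k≤n (spreadBelow-⊒ k)) (ψ-spreadBelow G k (<⇒≤ 1+k≤n))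

  ψ-round : ∀ s G → ψ (round s G) ≤ ψ G + 1
  ψ-round s G = ≤-trans (ψ-addSource s (spreadBelow n G)) (+-monoˡ-≤ 1 (ψ-spreadBelow G n ≤-refl))

  ψ-fire : ∀ σ r → ψ (fire σ r) ≤ r
  ψ-fire σ zero    = ≤-reflexive (trans (sumBelow-const (3 + n) 0) (*-zeroʳ (3 + n)))
  ψ-fire σ (suc r) =
    ≤-trans (ψ-round _ (fire σ r)) (≤-trans (+-monoˡ-≤ 1 (ψ-fire σ r)) (≤-reflexive (+-comm r 1)))

  spreadCount+parity≤ψ : ∀ {G} → Padded G → spreadCount G + ind (parity (ψ G)) ≤ ψ G
  spreadCount+parity≤ψ {G} padded = +-cancelʳ-≤ 2 (spreadCount G + p) (ψ G) (begin
    spreadCount G + p + 2        ≤⟨ +-monoʳ-≤ (spreadCount G + p) initial ⟩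
    spreadCount G + p + P 0      ≡⟨ xy∙z≈xz∙y (spreadCount G) p (P 0) ⟩
    spreadCount G + P 0 + p      ≤⟨ +-monoˡ-≤ p (+-monoˡ-≤ (P 0) (sumBelow-monoˡ a (m≤n+m n 3))) ⟩
    sumBelow (3 + n) a + P 0 + p ≤⟨ +-monoˡ-≤ p (sumBelow-telescope (3 + n) step) ⟩
    ψ G + P (3 + n) + p          ≡⟨ +-assoc (ψ G) (P (3 + n)) p ⟩
    ψ G + (P (3 + n) + p)        ≡⟨ cong (ψ G +_) final ⟩
    ψ G + 2                      ∎)
    where
    open ≤-Reasoning
    a : ℕ → ℕ
    a j = ind (ignites G j)
    P : ℕ → ℕ
    P j = scanPotential (G j) (G (1 + j)) (G (2 + j)) (G (3 + j)) (parity (sumBelow j (ψAt G)))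
    p : ℕ
    p = ind (parity (ψ G))
    step : ∀ j → a j + P j ≤ ψAt G j + P (suc j)
    step j = subst (λ q → a j + P j ≤ ψAt G j + scanPotential (G (1 + j)) (G (2 + j)) (G (3 + j)) (G (4 + j)) q)
                   (sym (parity-+ (sumBelow j (ψAt G)) (ψAt G j)))
                   (scanPotential-step (G j) (G (1 + j)) (G (2 + j)) (G (3 + j)) (G (4 + j))
                                       (parity (sumBelow j (ψAt G))))
    initial : 2 ≤ P 0
    initial rewrite Padded.cell0 padded | Padded.cell1 padded = scanPotential-start (G 2) (G 3)
    final : P (3 + n) + p ≡ 2
    final = quiet (parity (ψ G)) (Padded.beyond padded (1 + n) (m≤n+m n 1))
                  (Padded.beyond padded (2 + n) (m≤n+m n 2)) (Padded.beyond padded (3 + n) (m≤n+m n 3))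
                  (Padded.beyond padded (4 + n) (m≤n+m n 4))
      where
      quiet : ∀ {a b c d} q → a ≡ false → b ≡ false → c ≡ false → d ≡ false →
              scanPotential a b c d q + ind q ≡ 2
      quiet q refl refl refl refl = scanPotential-end q

  spreadCount-fire : ∀ σ r → spreadCount (fire σ r) ≤ evenPart r
  spreadCount-fire σ r = ≤-evenPart (spreadCount+parity≤ψ (fire-padded σ r)) (ψ-fire σ r)

  burnedCount-fire : ∀ σ r → burnedCount (fire σ r) ≤ maxBurned r
  burnedCount-fire σ zero    = ≤-reflexive (trans (sumBelow-const n 0) (*-zeroʳ n))
  burnedCount-fire σ (suc r) = begin
    burnedCount (fire σ (suc r))
      ≤⟨ burnedCount-round _ (fire σ r) ⟩
    burnedCount (fire σ r) + spreadCount (fire σ r) + 1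
      ≤⟨ +-monoˡ-≤ 1 (+-mono-≤ (burnedCount-fire σ r) (spreadCount-fire σ r)) ⟩
    maxBurned r + evenPart r + 1
      ≡⟨ trans (+-assoc (maxBurned r) (evenPart r) 1) (cong (maxBurned r +_) (+-comm (evenPart r) 1)) ⟩
    maxBurned r + suc (evenPart r)
      ∎
    where open ≤-Reasoning

-- Cells versus the hypergraph tightPath

2≤∣p∣ : ∀ {m} {p : Subset m} {x y} → x ≢ y → x ∈ p → y ∈ p → 2 ≤ ∣ p ∣
2≤∣p∣ {p = p} {x} {y} x≢y x∈p y∈p =
  subst (_< ∣ p ∣) (∣⁅x⁆∣≡1 x) (p⊂q⇒∣p∣<∣q∣ (⁅x⁆⊆p , y , y∈p , x≢y⇒x∉⁅y⁆ (x≢y ∘ sym)))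
  where
  ⁅x⁆⊆p : ⁅ x ⁆ ⊆ p
  ⁅x⁆⊆p z∈⁅x⁆ = subst (_∈ p) (sym (x∈⁅y⁆⇒x≡y x z∈⁅x⁆)) x∈p

triple-cases : ∀ {i j} → i ≤ j → j ≤ 2 + i → j ≡ i ⊎ j ≡ 1 + i ⊎ j ≡ 2 + i
triple-cases {zero}  {zero}              _         _           = inj₁ refl
triple-cases {zero}  {suc zero}          _         _           = inj₂ (inj₁ refl)
triple-cases {zero}  {suc (suc zero)}    _         _           = inj₂ (inj₂ refl)
triple-cases {zero}  {suc (suc (suc j))} _         (s≤s (s≤s ()))
triple-cases {suc i} {suc j}             (s≤s i≤j) (s≤s j≤2+i) with triple-cases i≤j j≤2+i
... | inj₁ refl        = inj₁ refl
... | inj₂ (inj₁ refl) = inj₂ (inj₁ refl)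
... | inj₂ (inj₂ refl) = inj₂ (inj₂ refl)

triple-elim : ∀ (P : ℕ → Set) {i j} → i ≤ j → j ≤ 2 + i → P i → P (1 + i) → P (2 + i) → P j
triple-elim P i≤j j≤2+i p₀ p₁ p₂ with triple-cases i≤j j≤2+i
... | inj₁ refl        = p₀
... | inj₂ (inj₁ refl) = p₁
... | inj₂ (inj₂ refl) = p₂

-- Rounds past the end of the sequence get the source n, which addSource ignores.
sourceAt : ∀ {n k} → Vec (Fin n) k → ℕ → ℕ
sourceAt {n} []       _       = n
sourceAt     (u ∷ _)  zero    = toℕ u
sourceAt     (_ ∷ us) (suc r) = sourceAt us r

sourceAt-lookup : ∀ {n k} (us : Vec (Fin n) k) i → sourceAt us (toℕ i) ≡ toℕ (lookup us i)
sourceAt-lookup (_ ∷ _)  Fin.zero    = refl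
sourceAt-lookup (_ ∷ us) (Fin.suc i) = sourceAt-lookup us i

sourceAt-< : ∀ {n k} (us : Vec (Fin n) k) r → sourceAt us r < n → r < k
sourceAt-< []       r       n<n = ⊥-elim (<-irrefl refl n<n)
sourceAt-< (_ ∷ _)  zero    _   = s≤s z≤n
sourceAt-< (_ ∷ us) (suc r) lt  = s≤s (sourceAt-< us r lt)

sourceAt-tabulate : ∀ {n k} (g : ℕ → ℕ) (g<n : ∀ r → g r < n) r → r < k →
  sourceAt (tabulate {n = k} (λ i → fromℕ< (g<n (toℕ i)))) r ≡ g r
sourceAt-tabulate {k = suc k} g g<n zero    _         = toℕ-fromℕ< (g<n 0)
sourceAt-tabulate {k = suc k} g g<n (suc r) (s≤s r<k) = sourceAt-tabulate (g ∘ suc) (g<n ∘ suc) r r<k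

module TightPath (n : ℕ) where

  open Fire n

  tripleAt-∈⁻ : ∀ {i} {w : Fin n} → w ∈ tripleAt n i → i ≤ toℕ w × toℕ w ≤ 2 + i
  tripleAt-∈⁻ {i} {w} w∈
    with Equivalence.to T-∧ (Equivalence.from T-≡ (trans (sym (lookup∘tabulate _ w)) ([]=⇒lookup w∈)))
  ... | i≤w , w≤i+2 =
    toWitness {a? = i ≤? toℕ w} i≤w , subst (toℕ w ≤_) (+-comm i 2) (toWitness {a? = toℕ w ≤? i + 2} w≤i+2)

  tripleAt-∈⁺ : ∀ {i} {w : Fin n} → i ≤ toℕ w → toℕ w ≤ 2 + i → w ∈ tripleAt n i
  tripleAt-∈⁺ {i} {w} i≤w w≤2+i = lookup⇒[]= w _ (trans (lookup∘tabulate _ w) (Equivalence.to T-≡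
    (Equivalence.from T-∧ (fromWitness {a? = i ≤? toℕ w} i≤w ,
                           fromWitness {a? = toℕ w ≤? i + 2} (subst (toℕ w ≤_) (+-comm 2 i) w≤2+i)))))

  EdgeFires : (Fin n → Set) → ℕ → Fin n → Set
  EdgeFires F i v = 2 + i < n × i ≤ toℕ v × toℕ v ≤ 2 + i
                    × (∀ w → i ≤ toℕ w → toℕ w ≤ 2 + i → w ≢ v → F w)

  OthersBurned : State → ℕ → ℕ → Set
  OthersBurned G i v = ∀ j → i ≤ j → j ≤ 2 + i → j ≢ v → G (2 + j) ≡ true

  CellFires : State → ℕ → ℕ → Set
  CellFires G i v = 2 + i < n × i ≤ v × v ≤ 2 + i × OthersBurned G i v

  Spread⇒EdgeFires : ∀ {F v} → Spread (tightPath n) F v → ∃ λ i → EdgeFires F i v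
  Spread⇒EdgeFires (e , e∈ , _ , v∈e , others) with ∈-map⁻ (tripleAt n) e∈
  ... | i , i∈ , refl = i , 2+i<n (∈-upTo⁻ i∈) , proj₁ (tripleAt-∈⁻ v∈e) , proj₂ (tripleAt-∈⁻ v∈e) ,
                        λ w i≤w w≤2+i → others w (tripleAt-∈⁺ i≤w w≤2+i)
    where
    2+i<n : ∀ {m i} → i < m ∸ 2 → 2 + i < m
    2+i<n {suc (suc m)} i<m∸2 = s≤s (s≤s i<m∸2)

  EdgeFires⇒Spread : ∀ {F v i} → EdgeFires F i v → Spread (tightPath n) F v
  EdgeFires⇒Spread {F} {v} {i} (2+i<n , i≤v , v≤2+i , others) =
    tripleAt n i , ∈-map⁺ (tripleAt n) (∈-upTo⁺ i<n∸2) ,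
    2≤∣p∣ first≢second (tripleAt-∈⁺ (≤-reflexive (sym first≡)) (≤-trans (≤-reflexive first≡) (m≤n+m i 2)))
                       (tripleAt-∈⁺ (≤-trans (n≤1+n i) (≤-reflexive (sym second≡)))
                                    (≤-trans (≤-reflexive second≡) (n≤1+n (1 + i)))) ,
    tripleAt-∈⁺ i≤v v≤2+i ,
    λ w w∈ → others w (proj₁ (tripleAt-∈⁻ w∈)) (proj₂ (tripleAt-∈⁻ w∈))
    where
    i<n∸2 : i < n ∸ 2
    i<n∸2 = subst (_< n ∸ 2) (m+n∸m≡n 2 i) (∸-monoˡ-< 2+i<n (m≤m+n 2 i))
    first second : Fin n
    first  = fromℕ< (<-trans (n<1+n i) (<-trans (n<1+n (1 + i)) 2+i<n))
    second = fromℕ< (<-trans (n<1+n (1 + i)) 2+i<n)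
    first≡ : toℕ first ≡ i
    first≡ = toℕ-fromℕ< _
    second≡ : toℕ second ≡ 1 + i
    second≡ = toℕ-fromℕ< _
    first≢second : first ≢ second
    first≢second first≡second = m≢1+n+m i {0} (trans (sym first≡) (trans (cong toℕ first≡second) second≡))

  CellFires⇒catchesAt : ∀ {G i v} → CellFires G i v → catchesAt G v ≡ true
  CellFires⇒catchesAt {G} {i} {v} (_ , i≤v , v≤2+i , others) =
    triple-elim (λ v → OthersBurned G i v → catchesAt G v ≡ true) i≤v v≤2+i
      (λ others → catches-right {G i} {G (1 + i)}
                    (others (1 + i) i≤1+i 1+i≤2+i (≢-sym i≢1+i)) (others (2 + i) i≤2+i ≤-refl (≢-sym i≢2+i)))
      (λ others → catches-middle {G (1 + i)} {e = G (5 + i)}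
                    (others i ≤-refl i≤2+i i≢1+i) (others (2 + i) i≤2+i ≤-refl (≢-sym 1+i≢2+i)))
      (λ others → catches-left {d = G (5 + i)} {e = G (6 + i)}
                    (others i ≤-refl i≤2+i i≢2+i) (others (1 + i) i≤1+i 1+i≤2+i 1+i≢2+i))
      others
    where
    i≤1+i : i ≤ 1 + i
    i≤1+i = n≤1+n i
    1+i≤2+i : 1 + i ≤ 2 + i
    1+i≤2+i = n≤1+n (1 + i)
    i≤2+i : i ≤ 2 + i
    i≤2+i = m≤n+m i 2
    i≢1+i : i ≢ 1 + i
    i≢1+i = m≢1+n+m i {0}
    i≢2+i : i ≢ 2 + i
    i≢2+i = m≢1+n+m i {1}
    1+i≢2+i : 1 + i ≢ 2 + i
    1+i≢2+i = m≢1+n+m (1 + i) {0}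

  catchesAt⇒CellFires : ∀ {G} v → Padded G → v < n → catchesAt G v ≡ true → ∃ λ i → CellFires G i v
  catchesAt⇒CellFires {G} v padded v<n catch = byCase v v<n (catches-cases catch)
    where
    others : ∀ {i v} → (i ≢ v → G (2 + i) ≡ true) → (1 + i ≢ v → G (3 + i) ≡ true) →
             (2 + i ≢ v → G (4 + i) ≡ true) → OthersBurned G i v
    others {i} {v} p₀ p₁ p₂ j i≤j j≤2+i = triple-elim (λ j → j ≢ v → G (2 + j) ≡ true) i≤j j≤2+i p₀ p₁ p₂
    byCase : ∀ v → v < n →
      (G v ≡ true × G (1 + v) ≡ true) ⊎ (G (1 + v) ≡ true × G (3 + v) ≡ true)
        ⊎ (G (3 + v) ≡ true × G (4 + v) ≡ true) →
      ∃ λ i → CellFires G i v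
    byCase zero          _     (inj₁ (G0 , _))             = ⊥-elim (clash (Padded.cell0 padded) G0)
    byCase (suc zero)    _     (inj₁ (G1 , _))             = ⊥-elim (clash (Padded.cell1 padded) G1)
    byCase (suc (suc i)) 2+i<n (inj₁ (G2+i , G3+i))        =
      i , 2+i<n , m≤n+m i 2 , ≤-refl , others (λ _ → G2+i) (λ _ → G3+i) (λ 2+i≢2+i → ⊥-elim (2+i≢2+i refl))
    byCase zero          _     (inj₂ (inj₁ (G1 , _)))      = ⊥-elim (clash (Padded.cell1 padded) G1)
    byCase (suc i)       _     (inj₂ (inj₁ (G2+i , G4+i))) =
      i , padded-< padded G4+i , n≤1+n i , n≤1+n (1 + i) ,
      others (λ _ → G2+i) (λ 1+i≢1+i → ⊥-elim (1+i≢1+i refl)) (λ _ → G4+i)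
    byCase v             _     (inj₂ (inj₂ (G3+v , G4+v))) =
      v , padded-< padded G4+v , ≤-refl , m≤n+m v 2 ,
      others (λ v≢v → ⊥-elim (v≢v refl)) (λ _ → G3+v) (λ _ → G4+v)

  module _ {k} (us : Vec (Fin n) k) where

    private
      σ : Strategy
      σ = oblivious (sourceAt us)

    Burned⇒fire : ∀ r v → Burned (tightPath n) us r v → fire σ r (2 + toℕ v) ≡ true
    Burned⇒fire (suc r) v (inj₁ earlier) = round-⊒ _ (Burned⇒fire r v earlier)
    Burned⇒fire (suc r) v (inj₂ (inj₁ spread)) with Spread⇒EdgeFires spread
    ... | i , 2+i<n , i≤v , v≤2+i , others =
      round-burns (caught (toℕ<n v) (CellFires⇒catchesAt {fire σ r} (2+i<n , i≤v , v≤2+i , cells)))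
      where
      cells : OthersBurned (fire σ r) i (toℕ v)
      cells j i≤j j≤2+i j≢v = subst (λ x → fire σ r (2 + x) ≡ true) (toℕ-fromℕ< j<n)
        (Burned⇒fire r w (others w (subst (i ≤_) (sym (toℕ-fromℕ< j<n)) i≤j)
                                   (subst (_≤ 2 + i) (sym (toℕ-fromℕ< j<n)) j≤2+i)
                                   (λ w≡v → j≢v (trans (sym (toℕ-fromℕ< j<n)) (cong toℕ w≡v)))))
        where
        j<n : j < n
        j<n = ≤-<-trans j≤2+i 2+i<n
        w : Fin n
        w = fromℕ< j<n
    Burned⇒fire (suc r) v (inj₂ (inj₂ (i , i≡r , lookup≡v))) =
      round-burns (is-source (sym source≡v) (subst (_< n) (sym source≡v) (toℕ<n v)))
      where
      source≡v : sourceAt us r ≡ toℕ v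
      source≡v = trans (cong (sourceAt us) (sym i≡r)) (trans (sourceAt-lookup us i) (cong toℕ lookup≡v))

    fire⇒Burned : ∀ r v → fire σ r (2 + toℕ v) ≡ true → Burned (tightPath n) us r v
    fire⇒Burned (suc r) v burns with round-burns⁻¹ burns
    ... | was-burned earlier = inj₁ (fire⇒Burned r v earlier)
    ... | caught _ catch with catchesAt⇒CellFires (toℕ v) (fire-padded σ r) (toℕ<n v) catch
    ...   | i , 2+i<n , i≤v , v≤2+i , cells =
      inj₂ (inj₁ (EdgeFires⇒Spread (2+i<n , i≤v , v≤2+i ,
        λ w i≤w w≤2+i w≢v → fire⇒Burned r w (cells (toℕ w) i≤w w≤2+i (w≢v ∘ toℕ-injective)))))
    fire⇒Burned (suc r) v burns | is-source v≡s s<n =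
      inj₂ (inj₂ (i , toℕ-fromℕ< r<k ,
                  toℕ-injective (trans (sym (sourceAt-lookup us i)) (trans source≡ (sym v≡s)))))
      where
      r<k : r < k
      r<k = sourceAt-< us r s<n
      i : Fin k
      i = fromℕ< r<k
      source≡ : sourceAt us (toℕ i) ≡ sourceAt us r
      source≡ = cong (sourceAt us) (toℕ-fromℕ< r<k)

-- Schedules for the upper bound

suc-⊓-pred : ∀ x m → 2 ≤ m → suc x ⊓ (m ∸ 1) ≡ suc (x ⊓ (m ∸ 2))
suc-⊓-pred x (suc (suc m)) _         = refl
suc-⊓-pred x (suc zero)    (s≤s ())

module Schedule (n : ℕ) where

  open Fire n

  fire-⊒ : ∀ σ d r → fire σ r ⊑ fire σ (d + r)
  fire-⊒ σ zero    r x burns = burns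
  fire-⊒ σ (suc d) r x burns = round-⊒ x (fire-⊒ σ d r x burns)

  BurnedBetween : State → ℕ → ℕ → Set
  BurnedBetween G a b = ∀ w → a ≤ w → w ≤ b → w < n → G (2 + w) ≡ true

  round-widens : ∀ {s G a b} → a < b → 1 + a < n → BurnedBetween G a b →
    BurnedBetween (round s G) (pred a) (1 + b)
  round-widens {s} {G} {a} {suc b} (s≤s a≤b) 1+a<n burned w a-1≤w w≤2+b w<n with w <? a | w ≤? suc b
  ... | yes w<a | _ =
    round-burns (caught w<n (catches-right {G w} {G (1 + w)}
      (subst (λ x → G (2 + x) ≡ true) a≡1+w (burned a ≤-refl (≤-trans a≤b (n≤1+n b)) (<-trans (n<1+n a) 1+a<n)))
      (subst (λ x → G (3 + x) ≡ true) a≡1+w (burned (1 + a) (n≤1+n a) (s≤s a≤b) 1+a<n))))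
    where
    a≡1+w : a ≡ 1 + w
    a≡1+w = ≤-antisym (≤-trans (m≤n+m∸n a 1) (+-monoʳ-≤ 1 a-1≤w)) w<a
  ... | no w≮a | yes w≤1+b = round-⊒ _ (burned w (≮⇒≥ w≮a) w≤1+b w<n)
  ... | no _   | no w≰1+b  =
    round-burns (caught w<n (catches-left {d = G (3 + w)} {e = G (4 + w)}
      (subst (λ x → G x ≡ true) (sym w≡2+b) (burned b a≤b (n≤1+n b) (<-trans (n<1+n b) 1+b<n)))
      (subst (λ x → G (1 + x) ≡ true) (sym w≡2+b) (burned (1 + b) (≤-trans a≤b (n≤1+n b)) ≤-refl 1+b<n))))
    where
    w≡2+b : w ≡ 2 + b
    w≡2+b = ≤-antisym w≤2+b (≰⇒> w≰1+b)
    1+b<n : 1 + b < n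
    1+b<n = <-trans (n<1+n (1 + b)) (subst (_< n) w≡2+b w<n)

  fire-widens : ∀ σ d {r a b} → a < b → 1 + a < n → BurnedBetween (fire σ r) a b →
    BurnedBetween (fire σ (d + r)) (a ∸ d) (d + b)
  fire-widens σ zero    _   _     burned = burned
  fire-widens σ (suc d) {r} {a} {b} a<b 1+a<n burned =
    subst (λ a′ → BurnedBetween (fire σ (suc d + r)) a′ (suc d + b)) (pred[m∸n]≡m∸[1+n] a d)
      (round-widens (≤-<-trans (m∸n≤m a d) (<-≤-trans a<b (m≤n+m b d)))
                    (≤-<-trans (s≤s (m∸n≤m a d)) 1+a<n)
                    (fire-widens σ d a<b 1+a<n burned))

  -- plan c off schedules c rounds that burn [off, off + maxBurned c): for c ≥ 2 a pair of adjacent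
  -- sources at the centre of the first 2c - 2 vertices, then the plan for c - 2 rounds; positions
  -- are clipped to the path.
  plan : ℕ → ℕ → ℕ → ℕ
  plan (suc (suc c)) off zero          = (off + c) ⊓ (n ∸ 2)
  plan (suc (suc c)) off (suc zero)    = suc (off + c) ⊓ (n ∸ 1)
  plan (suc (suc c)) off (suc (suc r)) = plan c (off + (2 + 2 * c)) r
  plan (suc zero)    off _             = off ⊓ (n ∸ 1)
  plan zero          _   _             = 0

  private
    n∸1<n : 1 ≤ n → n ∸ 1 < n
    n∸1<n 1≤n = ∸-monoʳ-< (s≤s z≤n) 1≤n

    +-suc-suc : ∀ a b → a + (2 + b) ≡ 2 + a + b
    +-suc-suc = solve-∀

    blockEnd : ∀ off c → off + (2 + 2 * c) ≡ suc (c + suc (off + c))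
    blockEnd = solve-∀

  plan-< : 1 ≤ n → ∀ c off r → plan c off r < n
  plan-< 1≤n (suc (suc c)) off zero          =
    ≤-<-trans (m⊓n≤n (off + c) (n ∸ 2)) (≤-<-trans (∸-monoʳ-≤ n (s≤s z≤n)) (n∸1<n 1≤n))
  plan-< 1≤n (suc (suc c)) off (suc zero)    = ≤-<-trans (m⊓n≤n (suc (off + c)) (n ∸ 1)) (n∸1<n 1≤n)
  plan-< 1≤n (suc (suc c)) off (suc (suc r)) = plan-< 1≤n c (off + (2 + 2 * c)) r
  plan-< 1≤n (suc zero)    off _             = ≤-<-trans (m⊓n≤n off (n ∸ 1)) (n∸1<n 1≤n)
  plan-< 1≤n zero          _   _             = 1≤n

  pair-burns : ∀ s t {L} → s t ≡ L → s (1 + t) ≡ 1 + L → BurnedBetween (fire (oblivious s) (2 + t)) L (1 + L)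
  pair-burns s t {L} first second w L≤w w≤1+L w<n with m≤n⇒m<n∨m≡n w≤1+L
  ... | inj₂ refl  = round-burns (is-source (sym second) (subst (_< n) (sym second) w<n))
  ... | inj₁ w<1+L =
    round-⊒ _ (round-burns (is-source (trans w≡L (sym first)) (subst (_< n) (trans w≡L (sym first)) w<n)))
    where
    w≡L : w ≡ L
    w≡L = ≤-antisym (≤-pred w<1+L) L≤w

  cover-firstBlock : ∀ c off t s → s t ≡ plan (2 + c) off 0 → s (1 + t) ≡ plan (2 + c) off 1 →
    ∀ v → off ≤ v → v < off + (2 + 2 * c) → v < n → fire (oblivious s) (c + (2 + t)) (2 + v) ≡ true
  cover-firstBlock c off t s first second v off≤v v<block v<n with 2 ≤? n
  ... | no n≱2 =
    subst (λ r → fire (oblivious s) r (2 + v) ≡ true) (sym (+-suc c (suc t)))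
      (fire-⊒ (oblivious s) (suc c) (suc t) (2 + v)
        (round-burns (is-source (trans v≡0 (sym source≡0)) (subst (_< n) (trans v≡0 (sym source≡0)) v<n))))
    where
    n≤1 : n ≤ 1
    n≤1 = ≤-pred (≰⇒> n≱2)
    v≡0 : v ≡ 0
    v≡0 = n≤0⇒n≡0 (≤-pred (≤-trans v<n n≤1))
    source≡0 : s t ≡ 0
    source≡0 = trans first (trans (cong ((off + c) ⊓_) (m≤n⇒m∸n≡0 (≤-trans n≤1 (n≤1+n 1)))) (⊓-zeroʳ (off + c)))
  ... | yes 2≤n = fire-widens (oblivious s) c (n<1+n L) 1+L<n
                    (pair-burns s t first (trans second (suc-⊓-pred (off + c) n 2≤n))) v L∸c≤v v≤c+1+L v<n
    where
    L : ℕ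
    L = (off + c) ⊓ (n ∸ 2)
    n≡2+[n∸2] : n ≡ 2 + (n ∸ 2)
    n≡2+[n∸2] = sym (m+[n∸m]≡n 2≤n)
    1+L<n : 1 + L < n
    1+L<n = ≤-<-trans (s≤s (m⊓n≤n (off + c) (n ∸ 2))) (subst (suc (n ∸ 2) <_) (sym n≡2+[n∸2]) ≤-refl)
    L∸c≤v : L ∸ c ≤ v
    L∸c≤v = ≤-trans (∸-monoˡ-≤ c (m⊓n≤m (off + c) (n ∸ 2))) (≤-trans (≤-reflexive (m+n∸n≡m off c)) off≤v)
    v≤c+1+L : v ≤ c + (1 + L)
    v≤c+1+L = subst (v ≤_) (sym (+-distribˡ-⊓ c (suc (off + c)) (suc (n ∸ 2))))
                (⊓-glb (≤-pred (subst (v <_) (blockEnd off c) v<block))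
                       (≤-trans (≤-pred (subst (v <_) n≡2+[n∸2] v<n)) (m≤n+m _ c)))

  cover : ∀ c off t s → (∀ r → r < c → s (r + t) ≡ plan c off r) →
    ∀ v → off ≤ v → v < off + maxBurned c → v < n → fire (oblivious s) (c + t) (2 + v) ≡ true
  cover zero off t s _ v off≤v v<off+0 _ = ⊥-elim (<⇒≱ (subst (v <_) (+-identityʳ off) v<off+0) off≤v)
  cover (suc zero) off t s planned v off≤v v<off+1 v<n =
    round-burns (is-source (trans v≡off (sym source≡off)) (subst (_< n) (trans v≡off (sym source≡off)) v<n))
    where
    v≡off : v ≡ off
    v≡off = ≤-antisym (≤-pred (subst (v <_) (+-comm off 1) v<off+1)) off≤v
    source≡off : s t ≡ off
    source≡off = trans (planned 0 (s≤s z≤n)) (m≤n⇒m⊓n≡m (subst (_≤ n ∸ 1) v≡off (<⇒≤pred v<n)))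
  cover (suc (suc c)) off t s planned v off≤v v<end v<n =
    subst (λ r → fire (oblivious s) r (2 + v) ≡ true) (+-suc-suc c t) (inBlocks (v <? off + (2 + 2 * c)))
    where
    inBlocks : Dec (v < off + (2 + 2 * c)) → fire (oblivious s) (c + (2 + t)) (2 + v) ≡ true
    inBlocks (yes v<block) =
      cover-firstBlock c off t s (planned 0 (s≤s z≤n)) (planned 1 (s≤s (s≤s z≤n))) v off≤v v<block v<n
    inBlocks (no v≮block)  =
      cover c (off + (2 + 2 * c)) (2 + t) s
        (λ r r<c → trans (cong s (+-suc-suc r t)) (planned (2 + r) (s≤s (s≤s r<c))))
        v (≮⇒≥ v≮block) v<end′ v<n
      where
      v<end′ : v < off + (2 + 2 * c) + maxBurned c
      v<end′ = subst (v <_) (trans (cong (off +_) (trans (maxBurned-+2 c) (+-comm (maxBurned c) _)))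
                                   (sym (+-assoc off _ (maxBurned c)))) v<end

  freeVertexOr : ℕ → State → ℕ
  freeVertexOr d G with any? (λ (w : Fin n) → G (2 + toℕ w) ≟ᴮ false)
  ... | yes (w , _) = toℕ w
  ... | no  _       = d

  freeVertexOr-< : ∀ {d} G → d < n → freeVertexOr d G < n
  freeVertexOr-< G d<n with any? (λ (w : Fin n) → G (2 + toℕ w) ≟ᴮ false)
  ... | yes (w , _) = toℕ<n w
  ... | no  _       = d<n

  freeVertexOr-unburned : ∀ d G → burnedCount G < n → G (2 + freeVertexOr d G) ≡ false
  freeVertexOr-unburned d G count<n with any? (λ (w : Fin n) → G (2 + toℕ w) ≟ᴮ false)
  ... | yes (_ , unburned) = unburned
  ... | no  none           = ⊥-elim (<-irrefl (burnedCount-full {G} full) count<n)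
    where
    full : ∀ v → v < n → G (2 + v) ≡ true
    full v v<n = subst (λ x → G (2 + x) ≡ true) (toℕ-fromℕ< v<n)
                   (¬-not (λ unburned → none (fromℕ< v<n , unburned)))

  repair : (ℕ → ℕ) → Strategy
  repair p r G with G (2 + p r)
  ... | true  = freeVertexOr (p r) G
  ... | false = p r

  repair-< : ∀ {p} → (∀ r → p r < n) → ∀ r G → repair p r G < n
  repair-< {p} p<n r G with G (2 + p r)
  ... | true  = freeVertexOr-< G (p<n r)
  ... | false = p<n r

  repair-unburned : ∀ p r G → burnedCount G < n → G (2 + repair p r G) ≡ false
  repair-unburned p r G count<n with G (2 + p r) in planned
  ... | true  = freeVertexOr-unburned (p r) G count<n
  ... | false = planned

  fire-plan⊑fire-repair : ∀ p r → fire (oblivious p) r ⊑ fire (repair p) r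
  fire-plan⊑fire-repair p r = fire-⊑ (oblivious p) (repair p) r (λ j _ → burnedOrPlanned j)
    where
    burnedOrPlanned : ∀ j → fire (repair p) j (2 + p j) ≡ true ⊎ repair p j (fire (repair p) j) ≡ p j
    burnedOrPlanned j with fire (repair p) j (2 + p j)
    ... | true  = inj₁ refl
    ... | false = inj₂ refl

lowerBound : ∀ {n k} (us : Vec (Fin n) k) → IsBurningSequence (tightPath n) us → n ≤ maxBurned k
lowerBound {n} {k} us (_ , allBurned) = begin
  n                      ≡⟨ burnedCount-full {fire σ k} full ⟨
  burnedCount (fire σ k) ≤⟨ burnedCount-fire σ k ⟩
  maxBurned k            ∎
  where
  open ≤-Reasoning
  open Fire n
  open TightPath n
  σ : Strategy
  σ = oblivious (sourceAt us)
  full : ∀ v → v < n → fire σ k (2 + v) ≡ true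
  full v v<n = subst (λ x → fire σ k (2 + x) ≡ true) (toℕ-fromℕ< v<n) (Burned⇒fire us k _ (allBurned (fromℕ< v<n)))

upperBound : ∀ {n c} → 1 ≤ n → n ≤ maxBurned c → (∀ r → r < c → maxBurned r < n) →
  Σ (Vec (Fin n) c) (IsBurningSequence (tightPath n))
upperBound {n} {c} 1≤n n≤maxBurned maxBurned<n = us , sourcesUnburned , allBurned
  where
  open Fire n
  open TightPath n
  open Schedule n
  p : ℕ → ℕ
  p = plan c 0
  σ : Strategy
  σ = repair p
  choice : ℕ → ℕ
  choice r = σ r (fire σ r)
  choice<n : ∀ r → choice r < n
  choice<n r = repair-< (plan-< 1≤n c 0) r (fire σ r)
  us : Vec (Fin n) c
  us = tabulate (λ i → fromℕ< (choice<n (toℕ i)))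
  sourceAt-us : ∀ r → r < c → sourceAt us r ≡ choice r
  sourceAt-us = sourceAt-tabulate choice choice<n
  replayed : ∀ r → r ≤ c → fire (oblivious (sourceAt us)) r ⊑ fire σ r
  replayed r r≤c = fire-⊑ _ σ r (λ j j<r → inj₂ (sym (sourceAt-us j (<-≤-trans j<r r≤c))))
  sourcesUnburned : ∀ i → ¬ Burned (tightPath n) us (toℕ i) (lookup us i)
  sourcesUnburned i burned =
    clash (repair-unburned p r (fire σ r) (≤-<-trans (burnedCount-fire σ r) (maxBurned<n r (toℕ<n i))))
          (replayed r (<⇒≤ (toℕ<n i)) _
             (subst (λ x → fire (oblivious (sourceAt us)) r (2 + x) ≡ true) source≡ (Burned⇒fire us r _ burned)))
    where
    r : ℕ
    r = toℕ i
    source≡ : toℕ (lookup us i) ≡ choice r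
    source≡ = trans (sym (sourceAt-lookup us i)) (sourceAt-us r (toℕ<n i))
  allBurned : ∀ v → Burned (tightPath n) us c v
  allBurned v = fire⇒Burned us c v
    (fire-⊑ σ _ c (λ j j<c → inj₂ (sourceAt-us j j<c)) _ (fire-plan⊑fire-repair p c _ covered))
    where
    covered : fire (oblivious p) c (2 + toℕ v) ≡ true
    covered = subst (λ r → fire (oblivious p) r (2 + toℕ v) ≡ true) (+-identityʳ c)
      (cover c 0 0 p (λ r _ → cong p (+-identityʳ r)) (toℕ v) z≤n (<-≤-trans (toℕ<n v) n≤maxBurned) (toℕ<n v))

module _ {n : ℕ} (1≤n : 1 ≤ n) (c : ℕ) (ceilSqrt : IsCeilSqrt (2 * n ∸ 1) c) where

  private
    sq<2n-1 : pred c * pred c < 2 * n ∸ 1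
    sq<2n-1 = proj₁ ceilSqrt

    2n-1≤sq : 2 * n ∸ 1 ≤ c * c
    2n-1≤sq = proj₂ ceilSqrt

    1≤2n : 1 ≤ 2 * n
    1≤2n = ≤-trans 1≤n (m≤m+n n (n + 0))

    2n-1<2n : 2 * n ∸ 1 < 2 * n
    2n-1<2n = ∸-monoʳ-< (s≤s z≤n) 1≤2n

  ceilSqrt⇒n≤maxBurned : n ≤ maxBurned c
  ceilSqrt⇒n≤maxBurned = ≤-pred (*-cancelˡ-< 2 n (suc (maxBurned c)) (begin-strict
    2 * n                    ≡⟨ m∸n+n≡m 1≤2n ⟨
    2 * n ∸ 1 + 1            ≤⟨ +-monoˡ-≤ 1 (≤-trans 2n-1≤sq (≤2*maxBurned c)) ⟩
    2 * maxBurned c + 1      <⟨ ≤-reflexive (double-suc (maxBurned c)) ⟩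
    2 * suc (maxBurned c)    ∎))
    where
    open ≤-Reasoning
    double-suc : ∀ f → suc (2 * f + 1) ≡ 2 * suc f
    double-suc = solve-∀

  ceilSqrt⇒maxBurned< : ∀ r → r < c → maxBurned r < n
  ceilSqrt⇒maxBurned< r r<c = *-cancelˡ-< 2 (maxBurned r) n (begin-strict
    2 * maxBurned r            ≤⟨ *-monoʳ-≤ 2 (maxBurned-mono (<⇒≤pred r<c)) ⟩
    2 * maxBurned (pred c)     ≤⟨ 2*maxBurned≤ (pred c) ⟩
    pred c * pred c + 1        ≡⟨ +-comm _ 1 ⟩
    suc (pred c * pred c)      ≤⟨ sq<2n-1 ⟩
    2 * n ∸ 1                  <⟨ 2n-1<2n ⟩
    2 * n                      ∎)
    where open ≤-Reasoning

mainTheorem7 : ∀ (n : ℕ) → 1 ≤ n → ∀ (c : ℕ) → IsCeilSqrt (2 * n ∸ 1) c →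
                   IsBurningNumber (tightPath n) c
mainTheorem7 n 1≤n c ceilSqrt =
  upperBound 1≤n (ceilSqrt⇒n≤maxBurned 1≤n c ceilSqrt) (ceilSqrt⇒maxBurned< 1≤n c ceilSqrt) ,
  λ k us burning → ≮⇒≥ λ k<c → <⇒≱ (ceilSqrt⇒maxBurned< 1≤n c ceilSqrt k k<c) (lowerBound us burning)
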